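{- Let $(S,\rho)$ be a matroid scheme and $r\in\mathbb{Z}_{\ge0}$. If $x$ and $y$ are distinct maximal elements of $\rho^{ -1}(r)$ and $\ell\in x\wedge y$, then $\rho(\ell)<r$.
   Context: A finite poset $S$ is a simplicial poset if it has a unique minimum, is ranked, and each $S_{\le x}$ is isomorphic to the Boolean lattice of subsets of the atoms below $x$; $|x|$ is the rank of $x$. $x\vee y$ is the set of minimal common upper bounds and $x\wedge y$ the set of maximal common lower bounds of $x,y$ (a single element when $x\vee y\ne\emptyset$). A matroid scheme is $(S,\rho)$, $\rho:S\to\mathbb{Z}_{\ge0}$, with (M1) $0\le\rho(x)\le|x|$; (M2) $x\le y\Rightarrow\rho(x)\le\rho(y)$; (M3) $u\in x\vee y\Rightarrow\rho(x)+\rho(y)\ge\rho(u)+\rho(x\wedge y)$; (M4) $\ell\in x\wedge y$ and $\rho(x)=\rho(\ell)\Rightarrow x\vee y\ne\emptyset$; (M5) if $\rho(x)<\rho(y)$ there is an atom $a\le y$, $a\not\le x$ with $x\vee a\ne\emptyset$. -}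

module Defs where

open import Data.Nat using (ℕ; zero; suc; _+_; _<_) renaming (_≤_ to _≤ℕ_)
open import Data.Fin using (Fin)
open import Data.Fin.Subset using (Subset; _∈_; _⊆_)
open import Data.Product using (Σ; ∃; _×_; _,_)
open import Data.Sum using (_⊎_)
open import Relation.Nullary using (¬_)
open import Relation.Binary.PropositionalEquality using (_≡_; _≢_)
open import Relation.Binary.Structures using (IsPartialOrder)

record SimplicialPoset (n : ℕ) : Set₁ where
  field
    _≤_ : Fin n → Fin n → Set
    isPartialOrder : IsPartialOrder _≡_ _≤_

  _<ₚ_ : Fin n → Fin n → Set
  x <ₚ y = x ≤ y × x ≢ y

  _⋖_ : Fin n → Fin n → Set
  x ⋖ y = x <ₚ y × (∀ z → x <ₚ z → ¬ (z <ₚ y))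

  field
    bot : Fin n
    bot-min : ∀ x → bot ≤ x
    ∣_∣ : Fin n → ℕ
    rank-bot : ∣ bot ∣ ≡ 0
    rank-cover : ∀ x y → x ⋖ y → ∣ y ∣ ≡ suc ∣ x ∣

  IsAtom : Fin n → Set
  IsAtom a = bot ⋖ a

  AtomSubsetBelow : Fin n → Subset n → Set
  AtomSubsetBelow x A = ∀ {a} → a ∈ A → IsAtom a × a ≤ x

  field
    -- S_{≤x} is order-isomorphic to the Boolean lattice of subsets of the
    -- atoms below x (ordered by inclusion)
    boolean-to   : (x z : Fin n) → z ≤ x → Subset n
    boolean-from : (x : Fin n) (A : Subset n) → AtomSubsetBelow x A → Fin n
    boolean-to-ok : ∀ x z (p : z ≤ x) → AtomSubsetBelow x (boolean-to x z p)
    boolean-from-ok : ∀ x A (q : AtomSubsetBelow x A) → boolean-from x A q ≤ x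
    boolean-from-to : ∀ x z (p : z ≤ x) →
      boolean-from x (boolean-to x z p) (boolean-to-ok x z p) ≡ z
    boolean-to-from : ∀ x A (q : AtomSubsetBelow x A) →
      boolean-to x (boolean-from x A q) (boolean-from-ok x A q) ≡ A
    boolean-mono : ∀ x z w (p : z ≤ x) (q : w ≤ x) →
      z ≤ w → boolean-to x z p ⊆ boolean-to x w q
    boolean-reflect : ∀ x z w (p : z ≤ x) (q : w ≤ x) →
      boolean-to x z p ⊆ boolean-to x w q → z ≤ w

  -- u ∈ x ∨ y : u is a minimal common upper bound of x and y
  IsJoin : Fin n → Fin n → Fin n → Set
  IsJoin x y u = (x ≤ u × y ≤ u) ×
    (∀ v → x ≤ v → y ≤ v → v ≤ u → v ≡ u)

  -- ℓ ∈ x ∧ y : ℓ is a maximal common lower bound of x and y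
  IsMeet : Fin n → Fin n → Fin n → Set
  IsMeet x y ℓ = (ℓ ≤ x × ℓ ≤ y) ×
    (∀ v → v ≤ x → v ≤ y → ℓ ≤ v → v ≡ ℓ)

  JoinExists : Fin n → Fin n → Set
  JoinExists x y = ∃ λ u → IsJoin x y u

record MatroidScheme (n : ℕ) : Set₁ where
  field
    S : SimplicialPoset n
  open SimplicialPoset S public
  field
    ρ : Fin n → ℕ
    M1 : ∀ x → ρ x ≤ℕ ∣ x ∣
    M2 : ∀ x y → x ≤ y → ρ x ≤ℕ ρ y
    M3 : ∀ x y u ℓ → IsJoin x y u → IsMeet x y ℓ → ρ u + ρ ℓ ≤ℕ ρ x + ρ y
    M4 : ∀ x y ℓ → IsMeet x y ℓ → ρ x ≡ ρ ℓ → JoinExists x y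
    M5 : ∀ x y → ρ x < ρ y →
      ∃ λ a → IsAtom a × a ≤ y × ¬ (a ≤ x) × JoinExists x a

  IsMaxInFiber : ℕ → Fin n → Set
  IsMaxInFiber r x = ρ x ≡ r × (∀ z → ρ z ≡ r → x ≤ z → z ≡ x)

-- If ρ ℓ = r, then M4 supplies a join u of x and y, and submodularity (M3)
-- with ρ x = ρ y = ρ ℓ forces ρ u ≤ r, hence ρ u = r by monotonicity (M2).
-- Maximality of x and of y in ρ⁻¹(r) then gives x = u = y.
module Submission where

open import Defs
open import Data.Nat using (ℕ; _<_; _+_) renaming (_≤_ to _≤ℕ_)
open import Data.Nat.Properties using (≤-antisym; m≤n⇒m<n∨m≡n; +-cancelʳ-≤)
open import Data.Fin using (Fin)
open import Data.Product using (_,_)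
open import Data.Sum using (inj₁; inj₂)
open import Relation.Nullary using (contradiction)
open import Relation.Binary.PropositionalEquality using (_≢_; _≡_; sym; trans; subst)

module _ {n : ℕ} (M : MatroidScheme n) where
  open MatroidScheme M

  ρ-join≡ρˡ : ∀ {x y u ℓ} → IsJoin x y u → IsMeet x y ℓ → ρ ℓ ≡ ρ y → ρ u ≡ ρ x
  ρ-join≡ρˡ {x} {y} {u} {ℓ} join@((x≤u , _) , _) meet ρℓ≡ρy =
    ≤-antisym (+-cancelʳ-≤ (ρ ℓ) (ρ u) (ρ x) submodular) (M2 x u x≤u)
    where
    submodular : ρ u + ρ ℓ ≤ℕ ρ x + ρ ℓ
    submodular = subst (λ k → ρ u + ρ ℓ ≤ℕ ρ x + k) (sym ρℓ≡ρy) (M3 x y u ℓ join meet)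

  maxInFiber-meet-full-rank⇒≡ : ∀ {r x y ℓ} → IsMaxInFiber r x → IsMaxInFiber r y →
    IsMeet x y ℓ → ρ ℓ ≡ r → x ≡ y
  maxInFiber-meet-full-rank⇒≡ {r} {x} {y} {ℓ} (ρx≡r , max-x) (ρy≡r , max-y) meet ρℓ≡r
    with M4 x y ℓ meet (trans ρx≡r (sym ρℓ≡r))
  ... | u , join@((x≤u , y≤u) , _) = trans (sym (max-x u ρu≡r x≤u)) (max-y u ρu≡r y≤u)
    where
    ρu≡r : ρ u ≡ r
    ρu≡r = trans (ρ-join≡ρˡ join meet (trans ρℓ≡r (sym ρy≡r))) ρx≡r

lemma5p1 : {n : ℕ} (M : MatroidScheme n) (r : ℕ) (x y ℓ : Fin n) →
    x ≢ y →
    MatroidScheme.IsMaxInFiber M r x →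
    MatroidScheme.IsMaxInFiber M r y →
    MatroidScheme.IsMeet M x y ℓ →
    MatroidScheme.ρ M ℓ < r
lemma5p1 M r x y ℓ x≢y x-max@(ρx≡r , _) y-max meet@((ℓ≤x , _) , _)
  with m≤n⇒m<n∨m≡n (subst (ρ ℓ ≤ℕ_) ρx≡r (M2 ℓ x ℓ≤x))
  where open MatroidScheme M
... | inj₁ ρℓ<r = ρℓ<r
... | inj₂ ρℓ≡r = contradiction (maxInFiber-meet-full-rank⇒≡ M x-max y-max meet ρℓ≡r) x≢y
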